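{- Let $\alpha,\beta,\delta\in\mathbb{Z}$ with $\delta>0$, let $f(r)=(\alpha\cdot r+\beta)/\delta$ and $\mathring f(r)=(\alpha\cdot r+\beta)\%\delta$ for $r\in\mathbb{Z}$, and let $g:\mathbb{Z}\to\mathbb{Z}$ be any function. For any $q\in\mathbb{Z}$ such that $f(g(q)-1)<f(g(q))$, we have: if $r\in\mathbb{Z}$ and $f(r)=f(g(q))$, then $\mathring f(r)/\alpha=r-g(q)$.
   Context: For $n,\delta\in\mathbb{Z}$ with $\delta\neq0$, $n/\delta$ and $n\%\delta$ denote the quotient and remainder of Euclidean division: the unique integers $q,s$ with $n=q\cdot\delta+s$ and $0\le s<|\delta|$. The operators $\cdot$, $/$, $\%$ have equal precedence and associate left to right. -}

module Defs where

open import Data.Integer.Base using (ℤ; +_; +[1+_]; -[1+_]; _+_; _*_; _-_; 0ℤ)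
import Data.Integer.Base as ℤ

-- Euclidean quotient n / d and remainder n % d (remainder in [0, |d|)),
-- via the standard library's Euclidean _/_ and _%_.  The divisor-zero case
-- is set to 0 only to make the operations total; it is never used
-- meaningfully in the statement (the hypotheses force the divisors ≠ 0).
_÷_ : ℤ → ℤ → ℤ
n ÷ (+ 0) = 0ℤ
n ÷ d@(+[1+ _ ]) = n ℤ./ d
n ÷ d@(-[1+ _ ]) = n ℤ./ d

_mod_ : ℤ → ℤ → ℤ
n mod (+ 0) = n
n mod d@(+[1+ _ ]) = + (n ℤ.% d)
n mod d@(-[1+ _ ]) = + (n ℤ.% d)

infixl 7 _÷_ _mod_

f : ℤ → ℤ → ℤ → ℤ → ℤ
f α β δ r = (α * r + β) ÷ δ

f̊ : ℤ → ℤ → ℤ → ℤ → ℤ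
f̊ α β δ r = (α * r + β) mod δ

module Submission where

-- Write n₀ = α·g(q) + β = f(g q)·δ + s₀.  Since α·(g q − 1) + β = n₀ − α, the drop of f at g q
-- says n₀ − α lies below the multiple f(g q)·δ, i.e. s₀ < α (in particular α > 0).  If f(r) = f(g q)
-- then the remainder at r differs from s₀ by exactly α·r − α·g(q), so it equals (r − g q)·α + s₀
-- with 0 ≤ s₀ < α, and dividing by α leaves r − g q.

open import Defs
open import Data.Integer.Base
  using (ℤ; +_; +[1+_]; -[1+_]; _+_; _-_; _*_; _/_; _%_; _≤_; _<_; +≤+; +<+; 0ℤ; 1ℤ)
open import Data.Integer.Properties
open import Data.Integer.DivMod using (a≡a%n+[a/n]*n; n%d<d)
open import Data.Integer.Tactic.RingSolver using (solve-∀)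
open import Data.Nat.Base as ℕ using (ℕ; z≤n)
open import Data.Empty using (⊥-elim)
open import Function.Base using (_∘_)
open import Relation.Binary.Definitions using (tri<; tri≈; tri>)
open import Relation.Binary.PropositionalEquality
  using (_≡_; sym; trans; cong; subst; subst₂; module ≡-Reasoning)

m-n<o⇒m-o<n : ∀ {m n o} → m - n < o → m - o < n
m-n<o⇒m-o<n {m} {n} {o} =
  subst₂ _<_ (+-minus-telescope m n o) (o+[n-o]≡n n o) ∘ +-monoˡ-< (n - o)
  where
  o+[n-o]≡n : ∀ n o → o + (n - o) ≡ n
  o+[n-o]≡n = solve-∀

module _ (d : ℕ) .{{_ : ℕ.NonZero d}} where

  private
    D : ℤ
    D = + d

  n%d≡n-[n/d]*d : ∀ n → + (n % D) ≡ n - (n / D) * D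
  n%d≡n-[n/d]*d n = begin
    + (n % D)                               ≡⟨ s≡[s+x]-x (+ (n % D)) ((n / D) * D) ⟩
    (+ (n % D) + (n / D) * D) - (n / D) * D ≡⟨ cong (_- (n / D) * D) (sym (a≡a%n+[a/n]*n n D)) ⟩
    n - (n / D) * D                         ∎
    where
    open ≡-Reasoning
    s≡[s+x]-x : ∀ s x → s ≡ (s + x) - x
    s≡[s+x]-x = solve-∀

  [n/d]*d≤n : ∀ n → (n / D) * D ≤ n
  [n/d]*d≤n n = subst₂ _≤_ (+-identityˡ _) (sym (a≡a%n+[a/n]*n n D))
    (+-monoˡ-≤ ((n / D) * D) (+≤+ z≤n))

  n<[n/d]*d+d : ∀ n → n < (n / D) * D + D
  n<[n/d]*d+d n = subst₂ _<_ (sym (a≡a%n+[a/n]*n n D)) (+-comm D ((n / D) * D))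
    (+-monoˡ-< ((n / D) * D) (+<+ (n%d<d n D)))

  p<q⇒p*d+d≤q*d : ∀ {p q} → p < q → p * D + D ≤ q * D
  p<q⇒p*d+d≤q*d {p} {q} p<q =
    subst (_≤ q * D) (trans (suc-* p D) (+-comm D (p * D)))
      (*-monoʳ-≤-nonNeg D (i<j⇒suc[i]≤j p<q))

  /-unique : ∀ {n q} → q * D ≤ n → n < q * D + D → n / D ≡ q
  /-unique {n} {q} lo hi with <-cmp (n / D) q
  ... | tri≈ _ n/d≡q _ = n/d≡q
  ... | tri< n/d<q _ _ = ⊥-elim (<⇒≱ (n<[n/d]*d+d n) (≤-trans (p<q⇒p*d+d≤q*d n/d<q) lo))
  ... | tri> _ _ q<n/d = ⊥-elim (<⇒≱ hi (≤-trans (p<q⇒p*d+d≤q*d q<n/d) ([n/d]*d≤n n)))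

  n/d<q⇒n<q*d : ∀ {n q} → n / D < q → n < q * D
  n/d<q⇒n<q*d {n} n/d<q = <-≤-trans (n<[n/d]*d+d n) (p<q⇒p*d+d≤q*d n/d<q)

  [n-a]/d<n/d⇒n%d<a : ∀ n a → (n - a) / D < n / D → + (n % D) < a
  [n-a]/d<n/d⇒n%d<a n a drop =
    subst (_< a) (sym (n%d≡n-[n/d]*d n)) (m-n<o⇒m-o<n {n} {a} (n/d<q⇒n<q*d {n - a} drop))

  n/d≡m/d⇒n%d≡[n-m]+m%d : ∀ n m → n / D ≡ m / D → + (n % D) ≡ (n - m) + + (m % D)
  n/d≡m/d⇒n%d≡[n-m]+m%d n m n/d≡m/d = begin
    + (n % D)                   ≡⟨ n%d≡n-[n/d]*d n ⟩
    n - (n / D) * D             ≡⟨ cong (λ q → n - q * D) n/d≡m/d ⟩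
    n - (m / D) * D             ≡⟨ sym (+-minus-telescope n m _) ⟩
    (n - m) + (m - (m / D) * D) ≡⟨ cong (λ r → (n - m) + r) (sym (n%d≡n-[n/d]*d m)) ⟩
    (n - m) + + (m % D)         ∎
    where open ≡-Reasoning

[c*d+m]÷d≡c : ∀ c m d → + m < d → (c * d + + m) ÷ d ≡ c
[c*d+m]÷d≡c c m (+ 0) (+<+ ())
[c*d+m]÷d≡c c m d@(+[1+ k ]) m<d =
  /-unique (ℕ.suc k) (i≤i+j (c * d) (+ m)) (+-monoʳ-< (c * d) m<d)
[c*d+m]÷d≡c c m -[1+ _ ] ()

lemma1 : (α β δ : ℤ) → 0ℤ < δ → (g : ℤ → ℤ) → (q : ℤ)
       → f α β δ (g q - 1ℤ) < f α β δ (g q)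
       → (r : ℤ) → f α β δ r ≡ f α β δ (g q)
       → f̊ α β δ r ÷ α ≡ r - g q
lemma1 α β (+ 0) (+<+ ()) g q drop r same
lemma1 α β δ@(+[1+ k ]) _ g q drop r same = begin
  f̊ α β δ r ÷ α
    ≡⟨ cong (_÷ α) (n/d≡m/d⇒n%d≡[n-m]+m%d d (α * r + β) (α * G + β) same) ⟩
  ((α * r + β) - (α * G + β) + s₀) ÷ α
    ≡⟨ cong (λ n → (n + s₀) ÷ α) (affine-sub α β r G) ⟩
  ((r - G) * α + s₀) ÷ α
    ≡⟨ [c*d+m]÷d≡c (r - G) _ α s₀<α ⟩
  r - G
    ∎
  where
  open ≡-Reasoning
  d : ℕ
  d = ℕ.suc k
  G s₀ : ℤ
  G = g q
  s₀ = f̊ α β δ G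

  affine-pred : ∀ α β x → α * (x - 1ℤ) + β ≡ (α * x + β) - α
  affine-pred = solve-∀

  affine-sub : ∀ α β x y → (α * x + β) - (α * y + β) ≡ (x - y) * α
  affine-sub = solve-∀

  s₀<α : s₀ < α
  s₀<α = [n-a]/d<n/d⇒n%d<a d (α * G + β) α
    (subst (λ n → n / δ < f α β δ G) (affine-pred α β G) drop)
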